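{- Suppose that for every positive integer $n$ and every even integer $m\in\mathcal{I}_{n+1}$ there exist primes $p\in\mathcal{P}\cap\mathcal{I}_n$ and $q\in(\mathcal{P}\cap\mathcal{I}_n)\cup(\mathcal{P}\cap\mathcal{I}_{n+1})$ with $m=p+q$. Then every even natural number $m\geq 4$ is the sum of two primes.
   Context: $\mathcal{P}$ is the set of prime numbers and $p_i$ the $i$th prime. The primorial is $\#(0)=1$ and $\#(m)=\prod_{i=1}^{m}p_i$ for $m\geq1$. The $n$-primorial interval is $\mathcal{I}_n=\{x\in\mathbb{N} : \#(n-1)+1\leq x\leq \#(n)+1\}$. -}

module Defs where

open import Data.Nat using (ℕ; zero; suc; _+_; _*_; _≤_; _!)
open import Data.Nat.Primality using (Prime; prime?)
open import Data.Product using (_×_)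
open import Relation.Nullary using (yes; no)

-- first prime among k+1, k+2, ..., k+fuel (returns k+fuel if none; never
-- happens for fuel = k ! + 1 by Euclid's argument)
searchPrime : ℕ → ℕ → ℕ
searchPrime k zero = k
searchPrime k (suc fuel) with prime? (suc k)
... | yes _ = suc k
... | no _ = searchPrime (suc k) fuel

nextPrime : ℕ → ℕ
nextPrime k = searchPrime k (suc (k !))

-- p i = the i-th prime (1-indexed): p 1 = 2, p 2 = 3, ...; p 0 = 1 (unused)
p : ℕ → ℕ
p zero = 1
p (suc i) = nextPrime (p i)

# : ℕ → ℕ
# zero = 1
# (suc m) = # m * p (suc m)

-- membership in the n-primorial interval I_n = [#(n-1)+1, #(n)+1]
-- (used only for n ≥ 1)
InI : ℕ → ℕ → Set
InI zero x = (1 ≤ x) × (x ≤ 2)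
InI (suc n) x = (suc (# n) ≤ x) × (x ≤ suc (# (suc n)))

-- The intervals I₂, I₃, … tile [#(1) + 1, ∞) = [3, ∞), since consecutive ones share an
-- endpoint and #(n) grows without bound. So every even m ≥ 4 lies in some I_(n+1) with
-- n ≥ 1, and the hypothesis for that n writes m as a sum of two primes.
module Submission where

open import Defs
open import Data.Nat using (ℕ; zero; suc; _+_; _*_; _≤_; _<_; _!; z≤n; s≤s; _≤?_)
open import Data.Nat.Properties
open import Data.Nat.Primality using (Prime; prime?)
open import Data.Product using (Σ; _×_; _,_)
open import Data.Sum using (_⊎_)
open import Relation.Nullary using (yes; no)
open import Relation.Binary.PropositionalEquality using (_≡_; cong; sym)

k<searchPrime : ∀ k fuel → k < searchPrime k (suc fuel)
k<searchPrime k fuel with prime? (suc k)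
... | yes _ = ≤-refl
k<searchPrime k zero | no _ = ≤-refl
k<searchPrime k (suc fuel) | no _ = <-trans (n<1+n k) (k<searchPrime (suc k) fuel)

p[i]<p[1+i] : ∀ i → p i < p (suc i)
p[i]<p[1+i] i = k<searchPrime (p i) (p i !)

0<p : ∀ i → 0 < p i
0<p zero = s≤s z≤n
0<p (suc i) = <-trans (0<p i) (p[i]<p[1+i] i)

2≤p[1+i] : ∀ i → 2 ≤ p (suc i)
2≤p[1+i] i = ≤-trans (s≤s (0<p i)) (p[i]<p[1+i] i)

n<#n : ∀ n → n < # n
n<#n zero = s≤s z≤n
n<#n (suc n) = begin-strict
  1 + n            <⟨ +-mono-≤-< (≤-<-trans z≤n (n<#n n)) (n<#n n) ⟩
  # n + # n        ≡⟨ cong (# n +_) (sym (+-identityʳ (# n))) ⟩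
  2 * # n          ≡⟨ *-comm 2 (# n) ⟩
  # n * 2          ≤⟨ *-monoʳ-≤ (# n) (2≤p[1+i] n) ⟩
  # n * p (suc n)  ∎
  where
  open ≤-Reasoning

∈-consecutive-interval : (f : ℕ → ℕ) (N m : ℕ) → f 1 < m → m ≤ suc (f (2 + N)) →
                         Σ ℕ (λ n → 1 ≤ n × f n < m × m ≤ suc (f (suc n)))
∈-consecutive-interval f zero m lo hi = 1 , ≤-refl , lo , hi
∈-consecutive-interval f (suc N) m lo hi with m ≤? f (2 + N)
... | yes m≤ = ∈-consecutive-interval f N m lo (m≤n⇒m≤1+n m≤)
... | no m≰ = 2 + N , s≤s z≤n , ≰⇒> m≰ , hi

theorem4 : ((n : ℕ) → 1 ≤ n → (m : ℕ) → Σ ℕ (λ k → m ≡ 2 * k) → InI (suc n) m → Σ ℕ (λ p′ → Σ ℕ (λ q → Prime p′ × InI n p′ × Prime q × (InI n q ⊎ InI (suc n) q) × m ≡ p′ + q))) → (m : ℕ) → Σ ℕ (λ k → m ≡ 2 * k) → 4 ≤ m → Σ ℕ (λ p′ → Σ ℕ (λ q → Prime p′ × Prime q × m ≡ p′ + q))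
theorem4 hyp m even 4≤m with ∈-consecutive-interval # m m 2<m m≤1+#[2+m]
  where
  -- stands for # 1 < m: # 1 evaluates to 2
  2<m : 2 < m
  2<m = <-trans (n<1+n 2) 4≤m
  m≤1+#[2+m] : m ≤ suc (# (2 + m))
  m≤1+#[2+m] = m<n⇒m≤1+n (<-trans (m<n+m m (s≤s z≤n)) (n<#n (2 + m)))
... | n , 1≤n , m∈I[1+n] with hyp n 1≤n m even m∈I[1+n]
... | p′ , q , prime-p′ , _ , prime-q , _ , m≡p′+q = p′ , q , prime-p′ , prime-q , m≡p′+q
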